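{- Let $g\geq3$, let $m\geq1$ be an odd integer, and let $\Gamma=(\mathbb Z_m\times\mathbb Z_{4})\rtimes\mathbb Z_2$. Then an $RSM_\Gamma(\Gamma,g;[^{8m-1}m,\ ^{1}2])$ exists.
   Context: The generalized dihedral group $(\mathbb Z_m\times\mathbb Z_{4})\rtimes\mathbb Z_2$ has underlying set $(\mathbb Z_m\times\mathbb Z_{4})\times\mathbb Z_2$ and operation $(u,\tau)+(u',\tau')=(u+(-1)^\tau u',\tau+\tau')$. A list is a multiset; $[^{a}x,\ ^{b}y]$ has $a$ copies of $x$ and $b$ copies of $y$. For $S\subseteq\Gamma$, an $|S|$-list $\Sigma$ and $g\ge2$, a row-sum matrix $RSM_\Gamma(S,g;\Sigma)$ is an $|S|\times g$ matrix with entries in $\Gamma$ each of whose columns is a permutation of $S$, such that the multiset of left-to-right row sums is $\Sigma$. $RSM_\Gamma(S,g;L)$ with $L$ a list of positive integers means an $RSM_\Gamma(S,g;\Sigma)$ for some $\Sigma$ whose list of element orders equals $L$. -}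

module Defs where

open import Data.Nat using (ℕ; zero; suc; _∸_; _≤_; _<_; NonZero)
import Data.Nat as ℕ
open import Data.Nat.DivMod using (_mod_)
open import Data.Fin using (Fin; toℕ)
open import Data.Product using (_×_; _,_; ∃-syntax)
open import Data.List using (List; foldl; map; allFin; replicate; _++_; [_])
open import Data.List.Relation.Binary.Pointwise using (Pointwise)
open import Data.List.Relation.Binary.Permutation.Propositional using (_↭_)
open import Function.Definitions using (Bijective)
open import Relation.Binary.PropositionalEquality using (_≡_; _≢_)

module _ (n : ℕ) .{{_ : NonZero n}} where
  addZ : Fin n → Fin n → Fin n
  addZ a b = (toℕ a ℕ.+ toℕ b) mod n

  negZ : Fin n → Fin n
  negZ a = (n ∸ toℕ a) mod n

  zeroZ : Fin n
  zeroZ = 0 mod n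

-- Γ = (ℤ_m × ℤ_4) ⋊ ℤ_2, underlying set (ℤ_m × ℤ_4) × ℤ_2
module _ (m : ℕ) .{{_ : NonZero m}} where
  Γ : Set
  Γ = (Fin m × Fin 4) × Fin 2

  -- (u,τ)+(u',τ') = (u + (-1)^τ u', τ+τ')
  _⊕_ : Γ → Γ → Γ
  ((a , b) , Fin.zero) ⊕ ((a' , b') , τ') =
    ((addZ m a a' , addZ 4 b b') , τ')
  ((a , b) , Fin.suc τ) ⊕ ((a' , b') , τ') =
    ((addZ m a (negZ m a') , addZ 4 b (negZ 4 b')) , addZ 2 (Fin.suc τ) τ')

  e : Γ
  e = ((zeroZ m , zeroZ 4) , zeroZ 2)

  mul : ℕ → Γ → Γ
  mul zero x = e
  mul (suc k) x = mul k x ⊕ x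

  HasOrder : Γ → ℕ → Set
  HasOrder x k = 1 ≤ k × mul k x ≡ e × (∀ j → 1 ≤ j → j < k → mul j x ≢ e)

  sumL : List Γ → Γ
  sumL = foldl _⊕_ e

  -- An RSM_Γ(Γ, g; Σ): an |Γ| × g matrix (|Γ| = 8m) each of whose columns is
  -- a permutation of Γ; RowSums gives the list of left-to-right row sums.
  Matrix : ℕ → Set
  Matrix g = Fin (8 ℕ.* m) → Fin g → Γ

  ColumnsArePermsOfΓ : (g : ℕ) → Matrix g → Set
  ColumnsArePermsOfΓ g M = ∀ (j : Fin g) → Bijective _≡_ _≡_ (λ i → M i j)

  RowSums : (g : ℕ) → Matrix g → List Γ
  RowSums g M = map (λ i → sumL (map (M i) (allFin g))) (allFin (8 ℕ.* m))

  -- RSM_Γ(Γ, g; L) for a list L of positive integers: exists a matrix whose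
  -- row sums have list of orders equal (as multisets) to L
  RSM-orders : (g : ℕ) → List ℕ → Set
  RSM-orders g L = ∃[ M ] (ColumnsArePermsOfΓ g M ×
                    ∃[ ords ] (Pointwise HasOrder (RowSums g M) ords × ords ↭ L))

{-# OPTIONS --safe #-}
module Submission where

-- Write x ∈ Γ as (a, δ) with a in the cyclic subgroup ℤ_m and δ in the quotient D = ℤ₄ ⋊ ℤ₂.
-- For g = 3 the columns are x, second x and third x, where second and third act fibrewise:
-- δ is moved by fixed permutations π₂, π₃ of D and a by a ↦ ±a + k₂ and a ↦ ±(-2a) + k₃.
-- The signs make the a-terms of the row sum cancel and π₂, π₃ make its D-part trivial, so
-- the row sum is ±1 or 2 in ℤ_m, of order m since m is odd. On the fibre a = 0
-- the D-coordinate is first twisted by σ, which turns the row of the identity into the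
-- involution ((0, 2), 0) without spoiling the other rows of that fibre. Further columns come
-- in pairs x, x⁻¹, which do not change row sums. For even g the columns start with x and
-- companion x, where x ∙ companion x = doubling x for a bijection doubling fixing the
-- identity, followed by second and third applied to doubling x.

open import Defs
open import Data.Nat using (ℕ; _≤_; _∸_; _*_; _%_; NonZero; suc; _+_; _<_; z≤n; s≤s; >-nonZero⁻¹)
open import Data.List using (replicate; _++_; [_]; _∷_; foldl; map; allFin; tabulate)
open import Relation.Binary.PropositionalEquality
  using (_≡_; _≢_; refl; sym; trans; cong; cong₂; subst; isEquivalence; module ≡-Reasoning)

open import Algebra.Bundles using (AbelianGroup; Group)
import Algebra.Properties.AbelianGroup as AbelianGroupProperties
import Algebra.Properties.CommutativeSemigroup as CommutativeSemigroupProperties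
import Algebra.Properties.Group as GroupProperties
open import Data.Empty using (⊥-elim)
open import Data.Fin using (Fin; toℕ; zero; suc)
open import Data.Fin.Patterns using (0F; 1F; 2F; 3F)
open import Data.Fin.Properties using (toℕ-injective; toℕ<n; toℕ-fromℕ<; *↔×; all?)
  renaming (_≟_ to _≟ᶠ_)
open import Data.List.Properties using (map-tabulate)
open import Data.List.Relation.Binary.Pointwise using (Pointwise; []; _∷_)
open import Data.List.Relation.Binary.Permutation.Propositional.Properties using (∷↭∷ʳ)
open import Data.Nat.DivMod
open import Data.Nat.Divisibility using (_∣_; ∣⇒≤; m%n≡0⇒n∣m)
open import Data.Nat.Properties
  using (+-comm; +-assoc; *-comm; *-identityˡ; m+[n∸m]≡n; <⇒≤; <⇒≱)
open import Data.Nat.Tactic.RingSolver using (solve-∀)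
open import Data.Product using (_×_; _,_; proj₁; proj₂; ∃-syntax)
open import Data.Product.Algebra using (×-cong; ×-comm)
open import Data.Product.Function.Dependent.Propositional using (Σ-↔)
open import Data.Product.Properties using (≡-dec)
open import Data.Sum using (_⊎_; inj₁; inj₂)
open import Function.Base using (_∘_)
open import Function.Bundles using (_↔_; Inverse; mk↔ₛ′; Bijection)
open import Function.Properties.Inverse using (↔-refl; ↔-sym; ↔-trans; Inverse⇒Bijection)
open import Level using (0ℓ)
open import Relation.Nullary.Decidable using (Dec; True; toWitness)

open Inverse using (to; from)

conjugate : ∀ {A B : Set} → A ↔ B → B ↔ B → A ↔ A
conjugate i f = ↔-trans i (↔-trans f (↔-sym i))

[m%d+n]%d≡[m+n]%d : ∀ m n d .{{_ : NonZero d}} → (m % d + n) % d ≡ (m + n) % d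
[m%d+n]%d≡[m+n]%d m n d = begin
  (m % d + n) % d            ≡⟨ %-distribˡ-+ (m % d) n d ⟩
  (m % d % d + n % d) % d    ≡⟨ cong (λ z → (z + n % d) % d) (m%n%n≡m%n m d) ⟩
  (m % d + n % d) % d        ≡⟨ %-distribˡ-+ m n d ⟨
  (m + n) % d                ∎
  where open ≡-Reasoning

[m+n%d]%d≡[m+n]%d : ∀ m n d .{{_ : NonZero d}} → (m + n % d) % d ≡ (m + n) % d
[m+n%d]%d≡[m+n]%d m n d = begin
  (m + n % d) % d            ≡⟨ cong (_% d) (+-comm m (n % d)) ⟩
  (n % d + m) % d            ≡⟨ [m%d+n]%d≡[m+n]%d n m d ⟩
  (n + m) % d                ≡⟨ cong (_% d) (+-comm n m) ⟩
  (m + n) % d                ∎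
  where open ≡-Reasoning

[m%d*n]%d≡[m*n]%d : ∀ m n d .{{_ : NonZero d}} → (m % d * n) % d ≡ (m * n) % d
[m%d*n]%d≡[m*n]%d m n d = begin
  (m % d * n) % d            ≡⟨ %-distribˡ-* (m % d) n d ⟩
  (m % d % d * (n % d)) % d  ≡⟨ cong (λ z → (z * (n % d)) % d) (m%n%n≡m%n m d) ⟩
  (m % d * (n % d)) % d      ≡⟨ %-distribˡ-* m n d ⟨
  (m * n) % d                ∎
  where open ≡-Reasoning

module ZMod (n : ℕ) .{{_ : NonZero n}} where

  infixl 6 _⊞_
  infix  8 ⊟_
  infixr 7 _·_

  _⊞_ : Fin n → Fin n → Fin n
  _⊞_ = addZ n

  ⊟_ : Fin n → Fin n
  ⊟_ = negZ n

  𝟎 : Fin n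
  𝟎 = zeroZ n

  toℕ-mod : ∀ x → toℕ (x mod n) ≡ x % n
  toℕ-mod x = toℕ-fromℕ< (m%n<n x n)

  toℕ-⊞ : ∀ a b → toℕ (a ⊞ b) ≡ (toℕ a + toℕ b) % n
  toℕ-⊞ a b = toℕ-mod (toℕ a + toℕ b)

  0%n≡0 : 0 % n ≡ 0
  0%n≡0 = m<n⇒m%n≡m (>-nonZero⁻¹ n)

  toℕ-𝟎 : toℕ 𝟎 ≡ 0
  toℕ-𝟎 = trans (toℕ-mod 0) 0%n≡0

  toℕ-% : ∀ (a : Fin n) → toℕ a % n ≡ toℕ a
  toℕ-% a = m<n⇒m%n≡m (toℕ<n a)

  ⊞-comm : ∀ a b → a ⊞ b ≡ b ⊞ a
  ⊞-comm a b = cong (_mod n) (+-comm (toℕ a) (toℕ b))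

  ⊞-identityˡ : ∀ a → 𝟎 ⊞ a ≡ a
  ⊞-identityˡ a = toℕ-injective (begin
    toℕ (𝟎 ⊞ a)           ≡⟨ toℕ-⊞ 𝟎 a ⟩
    (toℕ 𝟎 + toℕ a) % n   ≡⟨ cong (λ z → (z + toℕ a) % n) toℕ-𝟎 ⟩
    toℕ a % n             ≡⟨ toℕ-% a ⟩
    toℕ a                 ∎)
    where open ≡-Reasoning

  ⊞-assoc : ∀ a b c → (a ⊞ b) ⊞ c ≡ a ⊞ (b ⊞ c)
  ⊞-assoc a b c = toℕ-injective (begin
    toℕ ((a ⊞ b) ⊞ c)                    ≡⟨ toℕ-⊞ (a ⊞ b) c ⟩
    (toℕ (a ⊞ b) + toℕ c) % n            ≡⟨ cong (λ z → (z + toℕ c) % n) (toℕ-⊞ a b) ⟩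
    ((toℕ a + toℕ b) % n + toℕ c) % n    ≡⟨ [m%d+n]%d≡[m+n]%d (toℕ a + toℕ b) (toℕ c) n ⟩
    (toℕ a + toℕ b + toℕ c) % n          ≡⟨ cong (_% n) (+-assoc (toℕ a) (toℕ b) (toℕ c)) ⟩
    (toℕ a + (toℕ b + toℕ c)) % n        ≡⟨ [m+n%d]%d≡[m+n]%d (toℕ a) (toℕ b + toℕ c) n ⟨
    (toℕ a + (toℕ b + toℕ c) % n) % n    ≡⟨ cong (λ z → (toℕ a + z) % n) (toℕ-⊞ b c) ⟨
    (toℕ a + toℕ (b ⊞ c)) % n            ≡⟨ toℕ-⊞ a (b ⊞ c) ⟨
    toℕ (a ⊞ (b ⊞ c))                    ∎)
    where open ≡-Reasoning

  ⊞-inverseʳ : ∀ a → a ⊞ ⊟ a ≡ 𝟎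
  ⊞-inverseʳ a = toℕ-injective (begin
    toℕ (a ⊞ ⊟ a)                    ≡⟨ toℕ-⊞ a (⊟ a) ⟩
    (toℕ a + toℕ (⊟ a)) % n          ≡⟨ cong (λ z → (toℕ a + z) % n) (toℕ-mod (n ∸ toℕ a)) ⟩
    (toℕ a + (n ∸ toℕ a) % n) % n    ≡⟨ [m+n%d]%d≡[m+n]%d (toℕ a) (n ∸ toℕ a) n ⟩
    (toℕ a + (n ∸ toℕ a)) % n        ≡⟨ cong (_% n) (m+[n∸m]≡n (<⇒≤ (toℕ<n a))) ⟩
    n % n                            ≡⟨ n%n≡0 n ⟩
    0                                ≡⟨ toℕ-𝟎 ⟨
    toℕ 𝟎                            ∎)
    where open ≡-Reasoning

  abelianGroup : AbelianGroup 0ℓ 0ℓ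
  abelianGroup = record
    { Carrier = Fin n
    ; _≈_ = _≡_
    ; _∙_ = _⊞_
    ; ε = 𝟎
    ; _⁻¹ = ⊟_
    ; isAbelianGroup = record
      { isGroup = record
        { isMonoid = record
          { isSemigroup = record
            { isMagma = record { isEquivalence = isEquivalence ; ∙-cong = cong₂ _⊞_ }
            ; assoc = ⊞-assoc }
          ; identity = ⊞-identityˡ , λ a → trans (⊞-comm a 𝟎) (⊞-identityˡ a) }
        ; inverse = (λ a → trans (⊞-comm (⊟ a) a) (⊞-inverseʳ a)) , ⊞-inverseʳ
        ; ⁻¹-cong = cong ⊟_ }
      ; comm = ⊞-comm } }

  open AbelianGroup abelianGroup public using (identityʳ; inverseˡ)
  open AbelianGroupProperties abelianGroup public
    using (⁻¹-involutive; ε⁻¹≈ε; ⁻¹-∙-comm; //-rightDividesˡ; //-rightDividesʳ)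
  open CommutativeSemigroupProperties (AbelianGroup.commutativeSemigroup abelianGroup) public
    using (interchange)

  sgn : Fin 2 → Fin n → Fin n
  sgn 0F a = a
  sgn 1F a = ⊟ a

  sgn-⊞ : ∀ s a b → sgn s (a ⊞ b) ≡ sgn s a ⊞ sgn s b
  sgn-⊞ 0F a b = refl
  sgn-⊞ 1F a b = sym (⁻¹-∙-comm a b)

  sgn-involutive : ∀ s a → sgn s (sgn s a) ≡ a
  sgn-involutive 0F a = refl
  sgn-involutive 1F a = ⁻¹-involutive a

  sgn-𝟎 : ∀ s → sgn s 𝟎 ≡ 𝟎
  sgn-𝟎 0F = refl
  sgn-𝟎 1F = ε⁻¹≈ε

  ⊟↔ : Fin n ↔ Fin n
  ⊟↔ = mk↔ₛ′ ⊟_ ⊟_ ⁻¹-involutive ⁻¹-involutive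

  sgn↔ : Fin 2 → Fin n ↔ Fin n
  sgn↔ s = mk↔ₛ′ (sgn s) (sgn s) (sgn-involutive s) (sgn-involutive s)

  +↔ : Fin n → Fin n ↔ Fin n
  +↔ c = mk↔ₛ′ (_⊞ c) (_⊞ ⊟ c) (//-rightDividesˡ c) (//-rightDividesʳ c)

  signed-sum-cancel : ∀ {a} s₁ u₁ s₂ u₂ K₂ K₃ →
    sgn s₁ (sgn u₁ a) ≡ a → sgn s₂ (sgn u₂ (⊟ (a ⊞ a))) ≡ ⊟ (a ⊞ a) →
    (a ⊞ sgn s₁ (sgn u₁ a ⊞ K₂)) ⊞ sgn s₂ (sgn u₂ (⊟ (a ⊞ a)) ⊞ K₃) ≡ sgn s₁ K₂ ⊞ sgn s₂ K₃
  signed-sum-cancel {a} s₁ u₁ s₂ u₂ K₂ K₃ a-fixed 2a-fixed = begin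
    (a ⊞ sgn s₁ (sgn u₁ a ⊞ K₂)) ⊞ sgn s₂ (sgn u₂ (⊟ (a ⊞ a)) ⊞ K₃)
      ≡⟨ cong₂ (λ u v → (a ⊞ u) ⊞ v) (sgn-⊞ s₁ (sgn u₁ a) K₂) (sgn-⊞ s₂ (sgn u₂ (⊟ (a ⊞ a))) K₃) ⟩
    (a ⊞ (sgn s₁ (sgn u₁ a) ⊞ sgn s₁ K₂)) ⊞ (sgn s₂ (sgn u₂ (⊟ (a ⊞ a))) ⊞ sgn s₂ K₃)
      ≡⟨ cong₂ (λ u v → (a ⊞ (u ⊞ sgn s₁ K₂)) ⊞ (v ⊞ sgn s₂ K₃)) a-fixed 2a-fixed ⟩
    (a ⊞ (a ⊞ sgn s₁ K₂)) ⊞ (⊟ (a ⊞ a) ⊞ sgn s₂ K₃)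
      ≡⟨ cong (_⊞ (⊟ (a ⊞ a) ⊞ sgn s₂ K₃)) (⊞-assoc a a (sgn s₁ K₂)) ⟨
    ((a ⊞ a) ⊞ sgn s₁ K₂) ⊞ (⊟ (a ⊞ a) ⊞ sgn s₂ K₃)
      ≡⟨ interchange (a ⊞ a) (sgn s₁ K₂) (⊟ (a ⊞ a)) (sgn s₂ K₃) ⟩
    ((a ⊞ a) ⊞ ⊟ (a ⊞ a)) ⊞ (sgn s₁ K₂ ⊞ sgn s₂ K₃)
      ≡⟨ cong (_⊞ (sgn s₁ K₂ ⊞ sgn s₂ K₃)) (⊞-inverseʳ (a ⊞ a)) ⟩
    𝟎 ⊞ (sgn s₁ K₂ ⊞ sgn s₂ K₃)
      ≡⟨ ⊞-identityˡ (sgn s₁ K₂ ⊞ sgn s₂ K₃) ⟩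
    sgn s₁ K₂ ⊞ sgn s₂ K₃
      ∎
    where open ≡-Reasoning

  _·_ : ℕ → Fin n → Fin n
  0     · a = 𝟎
  suc j · a = j · a ⊞ a

  toℕ-· : ∀ j a → toℕ (j · a) ≡ (j * toℕ a) % n
  toℕ-· 0       a = trans toℕ-𝟎 (sym 0%n≡0)
  toℕ-· (suc j) a = begin
    toℕ (j · a ⊞ a)                  ≡⟨ toℕ-⊞ (j · a) a ⟩
    (toℕ (j · a) + toℕ a) % n        ≡⟨ cong (λ z → (z + toℕ a) % n) (toℕ-· j a) ⟩
    ((j * toℕ a) % n + toℕ a) % n    ≡⟨ [m%d+n]%d≡[m+n]%d (j * toℕ a) (toℕ a) n ⟩
    (j * toℕ a + toℕ a) % n          ≡⟨ cong (_% n) (+-comm (j * toℕ a) (toℕ a)) ⟩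
    (suc j * toℕ a) % n              ∎
    where open ≡-Reasoning

  n·a≡𝟎 : ∀ a → n · a ≡ 𝟎
  n·a≡𝟎 a = toℕ-injective (begin
    toℕ (n · a)         ≡⟨ toℕ-· n a ⟩
    (n * toℕ a) % n     ≡⟨ cong (_% n) (*-comm n (toℕ a)) ⟩
    (toℕ a * n) % n     ≡⟨ m*n%n≡0 (toℕ a) n ⟩
    0                   ≡⟨ toℕ-𝟎 ⟨
    toℕ 𝟎               ∎)
    where open ≡-Reasoning

  ·-⊟ : ∀ j a → j · ⊟ a ≡ ⊟ (j · a)
  ·-⊟ 0       a = sym ε⁻¹≈ε
  ·-⊟ (suc j) a = trans (cong (_⊞ ⊟ a) (·-⊟ j a)) (⁻¹-∙-comm (j · a) a)

  ·-⊞ : ∀ j a b → j · (a ⊞ b) ≡ j · a ⊞ j · b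
  ·-⊞ 0       a b = sym (⊞-identityˡ 𝟎)
  ·-⊞ (suc j) a b = trans (cong (_⊞ (a ⊞ b)) (·-⊞ j a b)) (interchange (j · a) (j · b) a b)

  IsGenerator : Fin n → Set
  IsGenerator c = ∀ j → j · c ≡ 𝟎 → n ∣ j

  one : Fin n
  one = 1 mod n

  one-generator : IsGenerator one
  one-generator j j·1≡𝟎 = m%n≡0⇒n∣m j n (begin
    j % n                  ≡⟨ cong (_% n) (*-identityˡ j) ⟨
    (1 * j) % n            ≡⟨ [m%d*n]%d≡[m*n]%d 1 j n ⟨
    (1 % n * j) % n        ≡⟨ cong (_% n) (*-comm (1 % n) j) ⟩
    (j * (1 % n)) % n      ≡⟨ cong (λ z → (j * z) % n) (toℕ-mod 1) ⟨
    (j * toℕ one) % n      ≡⟨ toℕ-· j one ⟨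
    toℕ (j · one)          ≡⟨ cong toℕ j·1≡𝟎 ⟩
    toℕ 𝟎                  ≡⟨ toℕ-𝟎 ⟩
    0                      ∎)
    where open ≡-Reasoning

  generator-⊟ : ∀ {c} → IsGenerator c → IsGenerator (⊟ c)
  generator-⊟ {c} gen j j·⊟c≡𝟎 = gen j (begin
    j · c          ≡⟨ ⁻¹-involutive (j · c) ⟨
    ⊟ ⊟ (j · c)    ≡⟨ cong ⊟_ (·-⊟ j c) ⟨
    ⊟ (j · ⊟ c)    ≡⟨ cong ⊟_ j·⊟c≡𝟎 ⟩
    ⊟ 𝟎            ≡⟨ ε⁻¹≈ε ⟩
    𝟎              ∎)
    where open ≡-Reasoning

  generator-double : (∀ {a b} → a ⊞ a ≡ b ⊞ b → a ≡ b) →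
    ∀ {c} → IsGenerator c → IsGenerator (c ⊞ c)
  generator-double double-injective {c} gen j j·2c≡𝟎 =
    gen j (double-injective (trans (sym (·-⊞ j c c)) (trans j·2c≡𝟎 (sym (⊞-identityˡ 𝟎)))))

  generator-sgn : ∀ s {c} → IsGenerator c → IsGenerator (sgn s c)
  generator-sgn 0F gen = gen
  generator-sgn 1F gen = generator-⊟ gen

  ±0±1-generator : ∀ s₁ s₂ → IsGenerator (sgn s₁ 𝟎 ⊞ sgn s₂ one)
  ±0±1-generator s₁ s₂ =
    subst IsGenerator (sym (trans (cong (_⊞ c) (sgn-𝟎 s₁)) (⊞-identityˡ c)))
      (generator-sgn s₂ one-generator)
    where
    c : Fin n
    c = sgn s₂ one

  ∓1±0-generator : ∀ s₁ s₂ → IsGenerator (sgn s₁ (⊟ one) ⊞ sgn s₂ 𝟎)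
  ∓1±0-generator s₁ s₂ =
    subst IsGenerator (sym (trans (cong (c ⊞_) (sgn-𝟎 s₂)) (identityʳ c)))
      (generator-sgn s₁ (generator-⊟ one-generator))
    where
    c : Fin n
    c = sgn s₁ (⊟ one)

-- The quotient of Γ by its cyclic subgroup ℤ_m: the dihedral group ℤ₄ ⋊ ℤ₂ of order 8.
D : Set
D = Fin 4 × Fin 2

module ΓGroup (m : ℕ) .{{_ : NonZero m}} where

  private
    module Zm = ZMod m
    module Z4 = ZMod 4

  infixl 6 _∙_
  infix  8 _⁻¹

  _∙_ : Γ m → Γ m → Γ m
  _∙_ = _⊕_ m

  ε : Γ m
  ε = e m

  _⁻¹ : Γ m → Γ m
  ((a , b) , 0F) ⁻¹ = ((Zm.⊟ a , Z4.⊟ b) , 0F)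
  ((a , b) , 1F) ⁻¹ = ((a , b) , 1F)

  private
    ext : ∀ {a a′ : Fin m} {b b′ : Fin 4} {τ : Fin 2} →
          a ≡ a′ → b ≡ b′ → ((a , b) , τ) ≡ ((a′ , b′) , τ)
    ext {τ = τ} = cong₂ (λ u v → ((u , v) , τ))

    module _ (n : ℕ) .{{_ : NonZero n}} where
      open ZMod n

      [a-b]-c≡a-[b+c] : ∀ a b c → (a ⊞ ⊟ b) ⊞ ⊟ c ≡ a ⊞ ⊟ (b ⊞ c)
      [a-b]-c≡a-[b+c] a b c = trans (⊞-assoc a (⊟ b) (⊟ c)) (cong (a ⊞_) (⁻¹-∙-comm b c))

      [a-b]+c≡a-[b-c] : ∀ a b c → (a ⊞ ⊟ b) ⊞ c ≡ a ⊞ ⊟ (b ⊞ ⊟ c)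
      [a-b]+c≡a-[b-c] a b c = begin
        (a ⊞ ⊟ b) ⊞ c        ≡⟨ ⊞-assoc a (⊟ b) c ⟩
        a ⊞ (⊟ b ⊞ c)        ≡⟨ cong (λ z → a ⊞ (⊟ b ⊞ z)) (⁻¹-involutive c) ⟨
        a ⊞ (⊟ b ⊞ ⊟ ⊟ c)    ≡⟨ cong (a ⊞_) (⁻¹-∙-comm b (⊟ c)) ⟩
        a ⊞ ⊟ (b ⊞ ⊟ c)      ∎
        where open ≡-Reasoning

  ∙-assoc : ∀ x y z → (x ∙ y) ∙ z ≡ x ∙ (y ∙ z)
  ∙-assoc ((a , b) , 0F) ((c , d) , 0F) ((p , q) , _) =
    ext (Zm.⊞-assoc a c p) (Z4.⊞-assoc b d q)
  ∙-assoc ((a , b) , 0F) ((c , d) , 1F) ((p , q) , _) =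
    ext (Zm.⊞-assoc a c (Zm.⊟ p)) (Z4.⊞-assoc b d (Z4.⊟ q))
  ∙-assoc ((a , b) , 1F) ((c , d) , 0F) ((p , q) , _) =
    ext ([a-b]-c≡a-[b+c] m a c p) ([a-b]-c≡a-[b+c] 4 b d q)
  ∙-assoc ((a , b) , 1F) ((c , d) , 1F) ((p , q) , 0F) =
    ext ([a-b]+c≡a-[b-c] m a c p) ([a-b]+c≡a-[b-c] 4 b d q)
  ∙-assoc ((a , b) , 1F) ((c , d) , 1F) ((p , q) , 1F) =
    ext ([a-b]+c≡a-[b-c] m a c p) ([a-b]+c≡a-[b-c] 4 b d q)

  ∙-identityˡ : ∀ x → ε ∙ x ≡ x
  ∙-identityˡ ((a , b) , _) = ext (Zm.⊞-identityˡ a) (Z4.⊞-identityˡ b)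

  ∙-identityʳ : ∀ x → x ∙ ε ≡ x
  ∙-identityʳ ((a , b) , 0F) = ext (Zm.identityʳ a) (Z4.identityʳ b)
  ∙-identityʳ ((a , b) , 1F) =
    ext (trans (cong (a Zm.⊞_) Zm.ε⁻¹≈ε) (Zm.identityʳ a))
        (trans (cong (b Z4.⊞_) Z4.ε⁻¹≈ε) (Z4.identityʳ b))

  ∙-inverseˡ : ∀ x → x ⁻¹ ∙ x ≡ ε
  ∙-inverseˡ ((a , b) , 0F) = ext (Zm.inverseˡ a) (Z4.inverseˡ b)
  ∙-inverseˡ ((a , b) , 1F) = ext (Zm.⊞-inverseʳ a) (Z4.⊞-inverseʳ b)

  ∙-inverseʳ : ∀ x → x ∙ x ⁻¹ ≡ ε
  ∙-inverseʳ ((a , b) , 0F) = ext (Zm.⊞-inverseʳ a) (Z4.⊞-inverseʳ b)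
  ∙-inverseʳ ((a , b) , 1F) = ext (Zm.⊞-inverseʳ a) (Z4.⊞-inverseʳ b)

  group : Group 0ℓ 0ℓ
  group = record
    { Carrier = Γ m
    ; _≈_ = _≡_
    ; _∙_ = _∙_
    ; ε = ε
    ; _⁻¹ = _⁻¹
    ; isGroup = record
      { isMonoid = record
        { isSemigroup = record
          { isMagma = record { isEquivalence = isEquivalence ; ∙-cong = cong₂ _∙_ }
          ; assoc = ∙-assoc }
        ; identity = ∙-identityˡ , ∙-identityʳ }
      ; inverse = ∙-inverseˡ , ∙-inverseʳ
      ; ⁻¹-cong = cong _⁻¹ } }

  open GroupProperties group using (⁻¹-involutive; //-rightDividesʳ)

  ⁻¹↔ : Γ m ↔ Γ m
  ⁻¹↔ = mk↔ₛ′ _⁻¹ _⁻¹ ⁻¹-involutive ⁻¹-involutive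

  alternating : ℕ → Γ m ↔ Γ m
  alternating 0             = ↔-refl
  alternating 1             = ⁻¹↔
  alternating (suc (suc j)) = alternating j

  foldl-alternating : ∀ t s x →
    foldl _∙_ s (tabulate {n = t * 2} (λ j → to (alternating (toℕ j)) x)) ≡ s
  foldl-alternating 0       s x = refl
  foldl-alternating (suc t) s x =
    trans (foldl-alternating t (s ∙ x ∙ x ⁻¹) x) (//-rightDividesʳ x s)

  Γ↔D×ℤ : Γ m ↔ (D × Fin m)
  Γ↔D×ℤ = mk↔ₛ′ (λ ((a , b) , t) → ((b , t) , a)) (λ ((b , t) , a) → ((a , b) , t))
    (λ _ → refl) (λ _ → refl)

  embed : Fin m → Γ m
  embed c = ((c , Z4.𝟎) , 0F)

  mul-embed : ∀ j c → mul m j (embed c) ≡ embed (j Zm.· c)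
  mul-embed 0       c = refl
  mul-embed (suc j) c = cong (_∙ embed c) (mul-embed j c)

  embed-order : ∀ {c} → Zm.IsGenerator c → HasOrder m (embed c) m
  embed-order {c} gen = >-nonZero⁻¹ m , top , below
    where
    top : mul m m (embed c) ≡ ε
    top = trans (mul-embed m c) (cong embed (Zm.n·a≡𝟎 c))
    below : ∀ j → 1 ≤ j → j < m → mul m j (embed c) ≢ ε
    below j@(suc _) _ j<m j·c≡ε =
      <⇒≱ j<m (∣⇒≤ (gen j (cong (λ x → proj₁ (proj₁ x)) (trans (sym (mul-embed j c)) j·c≡ε))))

  embed-order-≡ : ∀ {c c′} → c ≡ c′ → Zm.IsGenerator c′ → HasOrder m (embed c) m
  embed-order-≡ refl = embed-order

  rotation² : Γ m
  rotation² = ((Zm.𝟎 , 2F) , 0F)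

  rotation²-order : HasOrder m rotation² 2
  rotation²-order = s≤s z≤n , twice , λ { (suc 0) _ _ () ; (suc (suc _)) _ (s≤s (s≤s ())) }
    where
    twice : mul m 2 rotation² ≡ ε
    twice = cong (λ a → ((a , 0F) , 0F))
      (trans (cong (Zm._⊞ Zm.𝟎) (Zm.⊞-identityˡ Zm.𝟎)) (Zm.⊞-identityˡ Zm.𝟎))

module RowSumMatrix (n : ℕ) where

  private
    m : ℕ
    m = suc n

  open ΓGroup m

  -- Since m = suc n, index 0 computes to ε: row 0 is the row of ε.
  index : Fin (8 * m) ↔ Γ m
  index = ↔-trans (*↔× {8} {m}) (↔-trans (×-cong (*↔× {4} {2}) ↔-refl) (↔-sym Γ↔D×ℤ))

  rsm-of-columns : ∀ g (column : Fin g → Γ m ↔ Γ m) (rowSum : Γ m → Γ m) p q →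
    (∀ x → sumL m (tabulate (λ j → to (column j) x)) ≡ rowSum x) →
    HasOrder m (rowSum ε) p → (∀ x → x ≢ ε → HasOrder m (rowSum x) q) →
    RSM-orders m g (replicate (8 * m ∸ 1) q ++ [ p ])
  rsm-of-columns g column rowSum p q row-sum order-ε order-≢ε =
    M , columns-bijective , p ∷ replicate (8 * m ∸ 1) q , orders , ∷↭∷ʳ p (replicate (8 * m ∸ 1) q)
    where
    M : Matrix m g
    M i j = to (column j) (to index i)

    columns-bijective : ColumnsArePermsOfΓ m g M
    columns-bijective j = Bijection.bijective (Inverse⇒Bijection (↔-trans index (column j)))

    row-sum-M : ∀ i → sumL m (map (M i) (allFin g)) ≡ rowSum (to index i)
    row-sum-M i = trans (cong (sumL m) (map-tabulate (λ j → j) (M i))) (row-sum (to index i))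

    orders-off-ε : ∀ {k} (rows : Fin k → Fin (8 * m)) → (∀ i → rows i ≢ zero) →
      Pointwise (HasOrder m) (map (λ i → sumL m (map (M i) (allFin g))) (tabulate rows))
                (replicate k q)
    orders-off-ε {0}     rows rows≢0 = []
    orders-off-ε {suc k} rows rows≢0 =
      subst (λ x → HasOrder m x q) (sym (row-sum-M (rows zero))) (order-≢ε _ off-ε)
      ∷ orders-off-ε (λ i → rows (suc i)) (λ i → rows≢0 (suc i))
      where
      off-ε : to index (rows zero) ≢ ε
      off-ε eq = rows≢0 zero (Bijection.injective (Inverse⇒Bijection index) eq)

    orders : Pointwise (HasOrder m) (RowSums m g M) (p ∷ replicate (8 * m ∸ 1) q)
    orders = subst (λ x → HasOrder m x p) (sym (row-sum-M zero)) order-ε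
           ∷ orders-off-ε suc (λ _ ())

_≟ᴰ_ : (δ δ′ : D) → Dec (δ ≡ δ′)
_≟ᴰ_ = ≡-dec _≟ᶠ_ _≟ᶠ_

inverseOnD? : (f g : D → D) → Dec (∀ b t → f (g (b , t)) ≡ (b , t))
inverseOnD? f g = all? λ b → all? λ t → f (g (b , t)) ≟ᴰ (b , t)

permutation : (f g : D → D) → True (inverseOnD? f g) → True (inverseOnD? g f) → D ↔ D
permutation f g fg gf =
  mk↔ₛ′ f g (λ (b , t) → toWitness fg b t) (λ (b , t) → toWitness gf b t)

-- With δ · δ′ the product in D = ℤ₄ ⋊ ℤ₂: δ · π₂ δ · π₃ δ = 1 for every δ, while
-- δ · π₂ (σ δ) · π₃ (σ⁻¹ δ) = 1 for δ ≠ 1 and = (2, 0) for δ = 1; and δ · γ δ = φ δ.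
π₂ π₃ σ γ φ : D ↔ D
π₂ = permutation
  (λ { (0F , 0F) → (0F , 0F) ; (1F , 0F) → (1F , 0F) ; (2F , 0F) → (0F , 1F) ; (3F , 0F) → (1F , 1F)
     ; (0F , 1F) → (3F , 1F) ; (1F , 1F) → (2F , 1F) ; (2F , 1F) → (3F , 0F) ; (3F , 1F) → (2F , 0F) })
  (λ { (0F , 0F) → (0F , 0F) ; (1F , 0F) → (1F , 0F) ; (2F , 0F) → (3F , 1F) ; (3F , 0F) → (2F , 1F)
     ; (0F , 1F) → (2F , 0F) ; (1F , 1F) → (3F , 0F) ; (2F , 1F) → (1F , 1F) ; (3F , 1F) → (0F , 1F) })
  _ _
π₃ = permutation
  (λ { (0F , 0F) → (0F , 0F) ; (1F , 0F) → (2F , 0F) ; (2F , 0F) → (2F , 1F) ; (3F , 0F) → (0F , 1F)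
     ; (0F , 1F) → (3F , 0F) ; (1F , 1F) → (1F , 0F) ; (2F , 1F) → (3F , 1F) ; (3F , 1F) → (1F , 1F) })
  (λ { (0F , 0F) → (0F , 0F) ; (1F , 0F) → (1F , 1F) ; (2F , 0F) → (1F , 0F) ; (3F , 0F) → (0F , 1F)
     ; (0F , 1F) → (3F , 0F) ; (1F , 1F) → (3F , 1F) ; (2F , 1F) → (2F , 0F) ; (3F , 1F) → (2F , 1F) })
  _ _
σ = permutation
  (λ { (0F , 0F) → (1F , 1F) ; (1F , 1F) → (3F , 0F) ; (3F , 0F) → (0F , 0F) ; δ → δ })
  (λ { (0F , 0F) → (3F , 0F) ; (3F , 0F) → (1F , 1F) ; (1F , 1F) → (0F , 0F) ; δ → δ })
  _ _
γ = permutation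
  (λ { (0F , 0F) → (0F , 0F) ; (1F , 0F) → (1F , 0F) ; (2F , 0F) → (0F , 1F) ; (3F , 0F) → (1F , 1F)
     ; (0F , 1F) → (3F , 0F) ; (1F , 1F) → (2F , 0F) ; (2F , 1F) → (3F , 1F) ; (3F , 1F) → (2F , 1F) })
  (λ { (0F , 0F) → (0F , 0F) ; (1F , 0F) → (1F , 0F) ; (2F , 0F) → (1F , 1F) ; (3F , 0F) → (0F , 1F)
     ; (0F , 1F) → (2F , 0F) ; (1F , 1F) → (3F , 0F) ; (2F , 1F) → (3F , 1F) ; (3F , 1F) → (2F , 1F) })
  _ _
φ = permutation
  (λ { (0F , 0F) → (0F , 0F) ; (1F , 0F) → (2F , 0F) ; (2F , 0F) → (2F , 1F) ; (3F , 0F) → (0F , 1F)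
     ; (0F , 1F) → (1F , 1F) ; (1F , 1F) → (3F , 1F) ; (2F , 1F) → (3F , 0F) ; (3F , 1F) → (1F , 0F) })
  (λ { (0F , 0F) → (0F , 0F) ; (1F , 0F) → (3F , 1F) ; (2F , 0F) → (1F , 0F) ; (3F , 0F) → (2F , 1F)
     ; (0F , 1F) → (3F , 0F) ; (1F , 1F) → (0F , 1F) ; (2F , 1F) → (2F , 0F) ; (3F , 1F) → (1F , 1F) })
  _ _

module Construction (k : ℕ) where

  m : ℕ
  m = suc (k * 2)

  open ZMod m
  open ΓGroup m
  open RowSumMatrix (k * 2)

  half : Fin m → Fin m
  half y = (toℕ y * suc k) mod m

  half-double : ∀ a → half (a ⊞ a) ≡ a
  half-double a = toℕ-injective (begin
    toℕ (half (a ⊞ a))                    ≡⟨ toℕ-mod (toℕ (a ⊞ a) * suc k) ⟩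
    (toℕ (a ⊞ a) * suc k) % m             ≡⟨ cong (λ z → (z * suc k) % m) (toℕ-⊞ a a) ⟩
    ((toℕ a + toℕ a) % m * suc k) % m     ≡⟨ [m%d*n]%d≡[m*n]%d (toℕ a + toℕ a) (suc k) m ⟩
    ((toℕ a + toℕ a) * suc k) % m         ≡⟨ cong (_% m) (twice-half (toℕ a) k) ⟩
    (toℕ a + toℕ a * m) % m               ≡⟨ [m+kn]%n≡m%n (toℕ a) (toℕ a) m ⟩
    toℕ a % m                             ≡⟨ toℕ-% a ⟩
    toℕ a                                 ∎)
    where
    open ≡-Reasoning
    twice-half : ∀ a k → (a + a) * suc k ≡ a + a * suc (k * 2)
    twice-half = solve-∀

  double-half : ∀ y → half y ⊞ half y ≡ y
  double-half y = toℕ-injective (begin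
    toℕ (half y ⊞ half y)                ≡⟨ toℕ-⊞ (half y) (half y) ⟩
    (toℕ (half y) + toℕ (half y)) % m    ≡⟨ cong (λ z → (z + z) % m) (toℕ-mod (y′ * suc k)) ⟩
    ((y′ * suc k) % m + (y′ * suc k) % m) % m  ≡⟨ [m%d+n]%d≡[m+n]%d (y′ * suc k) _ m ⟩
    (y′ * suc k + (y′ * suc k) % m) % m  ≡⟨ [m+n%d]%d≡[m+n]%d (y′ * suc k) _ m ⟩
    (y′ * suc k + y′ * suc k) % m        ≡⟨ cong (_% m) (half-twice y′ k) ⟩
    (y′ + y′ * m) % m                    ≡⟨ [m+kn]%n≡m%n y′ y′ m ⟩
    y′ % m                               ≡⟨ toℕ-% y ⟩
    y′                                   ∎)
    where
    open ≡-Reasoning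
    y′ : ℕ
    y′ = toℕ y
    half-twice : ∀ y k → y * suc k + y * suc k ≡ y + y * suc (k * 2)
    half-twice = solve-∀

  double↔ : Fin m ↔ Fin m
  double↔ = mk↔ₛ′ (λ a → a ⊞ a) half double-half half-double

  double-injective : ∀ {a b} → a ⊞ a ≡ b ⊞ b → a ≡ b
  double-injective {a} {b} eq = trans (sym (half-double a)) (trans (cong half eq) (half-double b))

  fibred : D ↔ D → (D → Fin m ↔ Fin m) → Γ m ↔ Γ m
  fibred π L = conjugate Γ↔D×ℤ (Σ-↔ π (λ {δ} → L δ))

  twist₀ : D ↔ D → Γ m ↔ Γ m
  twist₀ τ = conjugate (↔-trans Γ↔D×ℤ (×-comm D (Fin m))) (Σ-↔ ↔-refl (λ {a} → on a))
    where
    on : Fin m → D ↔ D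
    on zero    = τ
    on (suc _) = ↔-refl

  k₂ k₃ : D → Fin m
  k₂ (3F , 0F) = ⊟ one
  k₂ _         = 𝟎
  k₃ (3F , 0F) = 𝟎
  k₃ _         = one

  -- the ℤ₂-component of x ∙ second x, which makes the fibre terms of tripleSum cancel
  e₃ : D → Fin 2
  e₃ δ = addZ 2 (proj₂ δ) (proj₂ (to π₂ δ))

  second third companion doubling : Γ m ↔ Γ m
  second = ↔-trans (twist₀ σ) (fibred π₂ λ δ → ↔-trans (sgn↔ (proj₂ δ)) (+↔ (k₂ δ)))
  third = ↔-trans (twist₀ (↔-sym σ))
    (fibred π₃ λ δ → ↔-trans double↔ (↔-trans ⊟↔ (↔-trans (sgn↔ (e₃ δ)) (+↔ (k₃ δ)))))
  companion = fibred γ λ δ → sgn↔ (proj₂ δ)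
  doubling = fibred φ λ _ → double↔

  tripleSum : Γ m → Γ m
  tripleSum x = x ∙ to second x ∙ to third x

  off-zero-sum : ∀ a δ → let s₁ = proj₂ δ ; s₂ = e₃ δ in
    (a ⊞ sgn s₁ (sgn s₁ a ⊞ k₂ δ)) ⊞ sgn s₂ (sgn s₂ (⊟ (a ⊞ a)) ⊞ k₃ δ)
      ≡ sgn s₁ (k₂ δ) ⊞ sgn s₂ (k₃ δ)
  off-zero-sum a δ = signed-sum-cancel s₁ s₁ s₂ s₂ (k₂ δ) (k₃ δ)
    (sgn-involutive s₁ a) (sgn-involutive s₂ (⊟ (a ⊞ a)))
    where
    s₁ s₂ : Fin 2
    s₁ = proj₂ δ
    s₂ = e₃ δ

  on-zero-sum : ∀ δ →
    let δ₂ = to σ δ ; δ₃ = from σ δ ; s₁ = proj₂ δ ; s₂ = addZ 2 s₁ (proj₂ (to π₂ δ₂)) in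
    (𝟎 ⊞ sgn s₁ (sgn (proj₂ δ₂) 𝟎 ⊞ k₂ δ₂)) ⊞ sgn s₂ (sgn (e₃ δ₃) (⊟ (𝟎 ⊞ 𝟎)) ⊞ k₃ δ₃)
      ≡ sgn s₁ (k₂ δ₂) ⊞ sgn s₂ (k₃ δ₃)
  on-zero-sum δ = signed-sum-cancel s₁ (proj₂ δ₂) s₂ (e₃ δ₃) (k₂ δ₂) (k₃ δ₃)
    (fixes-𝟎 s₁ (proj₂ δ₂) refl) (fixes-𝟎 s₂ (e₃ δ₃) -2·𝟎≡𝟎)
    where
    δ₂ δ₃ : D
    δ₂ = to σ δ
    δ₃ = from σ δ
    s₁ s₂ : Fin 2
    s₁ = proj₂ δ
    s₂ = addZ 2 s₁ (proj₂ (to π₂ δ₂))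
    fixes-𝟎 : ∀ s u {x} → x ≡ 𝟎 → sgn s (sgn u x) ≡ x
    fixes-𝟎 s u refl = trans (cong (sgn s) (sgn-𝟎 u)) (sgn-𝟎 s)
    -2·𝟎≡𝟎 : ⊟ (𝟎 ⊞ 𝟎) ≡ 𝟎
    -2·𝟎≡𝟎 = trans (cong ⊟_ (⊞-identityˡ 𝟎)) ε⁻¹≈ε

  two-generator : IsGenerator (⊟ ⊟ one ⊞ one)
  two-generator = subst IsGenerator (cong (_⊞ one) (sym (⁻¹-involutive one)))
    (generator-double double-injective one-generator)

  tripleSum-order : ∀ x → x ≢ ε → HasOrder m (tripleSum x) m
  tripleSum-order ((suc a , 0F) , 0F) _ =
    embed-order-≡ (off-zero-sum (suc a) (0F , 0F)) (±0±1-generator 0F 0F)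
  tripleSum-order ((suc a , 1F) , 0F) _ =
    embed-order-≡ (off-zero-sum (suc a) (1F , 0F)) (±0±1-generator 0F 0F)
  tripleSum-order ((suc a , 2F) , 0F) _ =
    embed-order-≡ (off-zero-sum (suc a) (2F , 0F)) (±0±1-generator 0F 1F)
  tripleSum-order ((suc a , 3F) , 0F) _ =
    embed-order-≡ (off-zero-sum (suc a) (3F , 0F)) (∓1±0-generator 0F 1F)
  tripleSum-order ((suc a , 0F) , 1F) _ =
    embed-order-≡ (off-zero-sum (suc a) (0F , 1F)) (±0±1-generator 1F 0F)
  tripleSum-order ((suc a , 1F) , 1F) _ =
    embed-order-≡ (off-zero-sum (suc a) (1F , 1F)) (±0±1-generator 1F 0F)
  tripleSum-order ((suc a , 2F) , 1F) _ =
    embed-order-≡ (off-zero-sum (suc a) (2F , 1F)) (±0±1-generator 1F 1F)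
  tripleSum-order ((suc a , 3F) , 1F) _ =
    embed-order-≡ (off-zero-sum (suc a) (3F , 1F)) (±0±1-generator 1F 1F)
  tripleSum-order ((zero  , 0F) , 0F) x≢ε = ⊥-elim (x≢ε refl)
  tripleSum-order ((zero  , 1F) , 0F) _ =
    embed-order-≡ (on-zero-sum (1F , 0F)) (±0±1-generator 0F 0F)
  tripleSum-order ((zero  , 2F) , 0F) _ =
    embed-order-≡ (on-zero-sum (2F , 0F)) (±0±1-generator 0F 1F)
  tripleSum-order ((zero  , 3F) , 0F) _ =
    embed-order-≡ (on-zero-sum (3F , 0F)) (±0±1-generator 0F 0F)
  tripleSum-order ((zero  , 0F) , 1F) _ =
    embed-order-≡ (on-zero-sum (0F , 1F)) (±0±1-generator 1F 0F)
  tripleSum-order ((zero  , 1F) , 1F) _ =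
    embed-order-≡ (on-zero-sum (1F , 1F)) two-generator
  tripleSum-order ((zero  , 2F) , 1F) _ =
    embed-order-≡ (on-zero-sum (2F , 1F)) (±0±1-generator 1F 1F)
  tripleSum-order ((zero  , 3F) , 1F) _ =
    embed-order-≡ (on-zero-sum (3F , 1F)) (±0±1-generator 1F 1F)

  tripleSum-ε : tripleSum ε ≡ rotation²
  tripleSum-ε = cong (λ a → ((a , 2F) , 0F))
    (trans (on-zero-sum (0F , 0F)) (trans (cong (𝟎 ⊞_) ε⁻¹≈ε) (⊞-identityˡ 𝟎)))

  tripleSum-ε-order : HasOrder m (tripleSum ε) 2
  tripleSum-ε-order = subst (λ y → HasOrder m y 2) (sym tripleSum-ε) rotation²-order

  ∙-companion : ∀ x → x ∙ to companion x ≡ to doubling x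
  ∙-companion ((a , 0F) , 0F) = refl
  ∙-companion ((a , 1F) , 0F) = refl
  ∙-companion ((a , 2F) , 0F) = refl
  ∙-companion ((a , 3F) , 0F) = refl
  ∙-companion ((a , 0F) , 1F) = cong (λ z → ((a ⊞ z , 1F) , 1F)) (⁻¹-involutive a)
  ∙-companion ((a , 1F) , 1F) = cong (λ z → ((a ⊞ z , 3F) , 1F)) (⁻¹-involutive a)
  ∙-companion ((a , 2F) , 1F) = cong (λ z → ((a ⊞ z , 3F) , 0F)) (⁻¹-involutive a)
  ∙-companion ((a , 3F) , 1F) = cong (λ z → ((a ⊞ z , 1F) , 0F)) (⁻¹-involutive a)

  oddColumns : ℕ → Γ m ↔ Γ m
  oddColumns 0                   = ↔-refl
  oddColumns 1                   = second
  oddColumns 2                   = third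
  oddColumns (suc (suc (suc j))) = alternating j

  evenColumns : ℕ → Γ m ↔ Γ m
  evenColumns 0                         = ↔-refl
  evenColumns 1                         = companion
  evenColumns 2                         = ↔-trans doubling second
  evenColumns 3                         = ↔-trans doubling third
  evenColumns (suc (suc (suc (suc j)))) = alternating j

  oddColumns-rowSum : ∀ t x →
    sumL m (tabulate {n = 3 + t * 2} (λ j → to (oddColumns (toℕ j)) x)) ≡ tripleSum x
  oddColumns-rowSum t x = trans (foldl-alternating t (ε ∙ x ∙ to second x ∙ to third x) x)
    (cong (λ y → y ∙ to second x ∙ to third x) (∙-identityˡ x))

  evenColumns-rowSum : ∀ t x →
    sumL m (tabulate {n = 4 + t * 2} (λ j → to (evenColumns (toℕ j)) x))
      ≡ tripleSum (to doubling x)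
  evenColumns-rowSum t x =
    trans (foldl-alternating t (ε ∙ x ∙ to companion x ∙ to second y ∙ to third y) x)
      (cong (λ z → z ∙ to second y ∙ to third y)
        (trans (cong (_∙ to companion x) (∙-identityˡ x)) (∙-companion x)))
    where
    y : Γ m
    y = to doubling x

  rsm-odd : ∀ t → RSM-orders m (3 + t * 2) (replicate (8 * m ∸ 1) m ++ [ 2 ])
  rsm-odd t = rsm-of-columns (3 + t * 2) (λ j → oddColumns (toℕ j)) tripleSum 2 m
    (oddColumns-rowSum t) tripleSum-ε-order tripleSum-order

  rsm-even : ∀ t → RSM-orders m (4 + t * 2) (replicate (8 * m ∸ 1) m ++ [ 2 ])
  rsm-even t = rsm-of-columns (4 + t * 2) (λ j → evenColumns (toℕ j))
    (λ x → tripleSum (to doubling x)) 2 m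
    (evenColumns-rowSum t) tripleSum-ε-order
    (λ x x≢ε → tripleSum-order (to doubling x) (x≢ε ∘ doubling-injective))
    where
    doubling-injective : ∀ {x} → to doubling x ≡ ε → x ≡ ε
    doubling-injective = Bijection.injective (Inverse⇒Bijection doubling)

≥3⇒odd⊎even : ∀ g → 3 ≤ g → (∃[ t ] g ≡ 3 + t * 2) ⊎ (∃[ t ] g ≡ 4 + t * 2)
≥3⇒odd⊎even 1 (s≤s ())
≥3⇒odd⊎even 2 (s≤s (s≤s ()))
≥3⇒odd⊎even 3 _ = inj₁ (0 , refl)
≥3⇒odd⊎even 4 _ = inj₂ (0 , refl)
≥3⇒odd⊎even (suc (suc g@(suc (suc (suc _))))) _ with ≥3⇒odd⊎even g (s≤s (s≤s (s≤s z≤n)))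
... | inj₁ (t , refl) = inj₁ (suc t , refl)
... | inj₂ (t , refl) = inj₂ (suc t , refl)

odd⇒1+2k : ∀ m → m % 2 ≡ 1 → ∃[ k ] suc (k * 2) ≡ m
odd⇒1+2k m odd = m / 2 , sym (trans (m≡m%n+[m/n]*n m 2) (cong (_+ m / 2 * 2) odd))

theorem3p5 : (g m : ℕ) .{{_ : NonZero m}} → 3 ≤ g → m % 2 ≡ 1 →
    RSM-orders m g (replicate (8 * m ∸ 1) m ++ [ 2 ])
theorem3p5 g m 3≤g odd with odd⇒1+2k m odd | ≥3⇒odd⊎even g 3≤g
... | k , refl | inj₁ (t , refl) = Construction.rsm-odd k t
... | k , refl | inj₂ (t , refl) = Construction.rsm-even k t
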